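{- Let $n\ge2$, $m\ge1$, and let $T\in\mathrm{Bi}(m,n)$ be equipped with an orientation, with set of external vertices $V_e$. Let $r\colon V_e\to V_e$ be the map sending an external vertex $v$ to the unique external vertex $w$ such that there is a reduced, well oriented path from $v$ to $w$. Then for every $v\in V_e$, \[V_e=\{r^i(v): 0\le i<|V_e|\}.\]
   Context: $\mathrm{Bi}(m,n)$ denotes the set of finite trees all of whose vertices have valence $1$ (external) or $n$ (internal) and which have exactly $m$ internal vertices. An orientation of $T$ is the choice, for each internal vertex $u$, of an $n$-cycle $\sigma_u$ permuting the $n$ vertices adjacent to $u$. A path $(u_0,\dots,u_k)$ is reduced if $u_{j-1}\ne u_{j+1}$ for all $j$, and well oriented if $\sigma_{u_j}(u_{j-1})=u_{j+1}$ for all $0<j<k$. For each external vertex $v$ there is a unique external $w$ and a unique reduced, well oriented path from $v$ to $w$, so $r$ is well defined. -}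

module Defs where

open import Data.Nat using (ℕ; zero; suc; _+_)
open import Data.Nat.Properties using (_≟_)
open import Data.Bool using (Bool; true; false; if_then_else_; T)
open import Data.Fin using (Fin)
open import Data.List using (List; []; _∷_; _++_; [_]; map; allFin)
open import Data.Nat.ListAction using (sum)
open import Data.List.Relation.Unary.Unique.Propositional using (Unique)
open import Data.Product using (Σ; ∃; _×_)
open import Data.Unit using (⊤)
open import Data.Sum using (_⊎_)
open import Relation.Binary.PropositionalEquality using (_≡_; _≢_)
open import Relation.Nullary.Decidable using (⌊_⌋)

count : {N : ℕ} → (Fin N → Bool) → ℕ
count {N} P = sum (map (λ j → if P j then 1 else 0) (allFin N))

iterate : {A : Set} → (A → A) → ℕ → A → A
iterate f zero    x = x
iterate f (suc i) x = f (iterate f i x)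

Edges : {N : ℕ} → (Fin N → Fin N → Bool) → List (Fin N) → Set
Edges adj (x ∷ y ∷ rest) = T (adj x y) × Edges adj (y ∷ rest)
Edges adj _              = ⊤

Reduced : {N : ℕ} → List (Fin N) → Set
Reduced (a ∷ b ∷ c ∷ rest) = a ≢ c × Reduced (b ∷ c ∷ rest)
Reduced _                  = ⊤

WellOriented : {N : ℕ} → (Fin N → Fin N → Fin N) → List (Fin N) → Set
WellOriented σ (a ∷ b ∷ c ∷ rest) = σ b a ≡ c × WellOriented σ (b ∷ c ∷ rest)
WellOriented σ _                  = ⊤

record Tree (N : ℕ) : Set where
  field
    adj       : Fin N → Fin N → Bool
    symmetric : ∀ x y → adj x y ≡ adj y x
    loopless  : ∀ x → adj x x ≡ false
    connected : ∀ x y → x ≢ y → ∃ λ (mid : List (Fin N)) → Edges adj (x ∷ mid ++ [ y ])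
    acyclic   : ∀ (p : List (Fin N)) → Edges adj p → Reduced p → Unique p

  degree : Fin N → ℕ
  degree u = count (adj u)

  Adjacent : Fin N → Fin N → Set
  Adjacent x y = T (adj x y)

open Tree public

record InBi {N : ℕ} (m n : ℕ) (t : Tree N) : Set where
  field
    valence  : ∀ u → degree t u ≡ 1 ⊎ degree t u ≡ n
    internal : count (λ u → ⌊ degree t u ≟ n ⌋) ≡ m

External : {N : ℕ} → Tree N → Fin N → Set
External t u = degree t u ≡ 1

Internal : {N : ℕ} → (n : ℕ) → Tree N → Fin N → Set
Internal n t u = degree t u ≡ n

-- σ is a cyclic permutation of the neighbours of u: it maps neighbours to
-- neighbours injectively and any neighbour reaches any other by iteration.
-- (u has exactly n neighbours when internal, so this is an n-cycle.)
IsCycleOnNeighbours : {N : ℕ} → Tree N → Fin N → (Fin N → Fin N) → Set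
IsCycleOnNeighbours t u σ =
  (∀ x → Adjacent t u x → Adjacent t u (σ x)) ×
  (∀ x y → Adjacent t u x → Adjacent t u y → σ x ≡ σ y → x ≡ y) ×
  (∀ x y → Adjacent t u x → Adjacent t u y → ∃ λ i → iterate σ i x ≡ y)

-- an orientation: σ u is an n-cycle on the neighbours of each internal u
-- (the values of σ u at external u are irrelevant)
IsOrientation : {N : ℕ} → (n : ℕ) → Tree N → (Fin N → Fin N → Fin N) → Set
IsOrientation n t σ = ∀ u → Internal n t u → IsCycleOnNeighbours t u (σ u)

RWOPath : {N : ℕ} → Tree N → (Fin N → Fin N → Fin N) → Fin N → Fin N → Set
RWOPath {N} t σ v w =
  ∃ λ (mid : List (Fin N)) →
    let p = v ∷ mid ++ [ w ] in
    Edges (adj t) p × Reduced p × WellOriented σ p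

isExternal : {N : ℕ} → Tree N → Fin N → Bool
isExternal t u = ⌊ degree t u ≟ 1 ⌋

numExternal : {N : ℕ} → Tree N → ℕ
numExternal t = count (isExternal t)

{-# OPTIONS --safe #-}
-- Darts (a , b) of the tree are permuted by next (a , b) = (b , σ_b a), a leaf b sending
-- (a , b) back to (b , a).  A closed walk in a tree that leaves a along the edge ab must
-- return along it, so the orbit of (a , b) contains (b , a); with the cyclicity of each
-- σ_b and connectedness, all darts form a single orbit.  From the dart leaving a leaf v
-- this orbit runs along the reduced well-oriented path to r v and then leaves r v, so the
-- leaves it meets are v, r v, r² v, ... in this order.  Hence every leaf is some rⁱ v,
-- and by pigeonhole already for some i < |V_e|.
module Submission where

open import Defs
open import Data.Bool using (Bool; true; false; T; if_then_else_)
open import Data.Empty using (⊥; ⊥-elim)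
import Data.Fin as Fin
open import Data.Fin using (Fin; toℕ; fromℕ<; combine)
open import Data.Fin.Properties
  using (pigeonhole; toℕ≤pred[n]; fromℕ<-injective; combine-injective)
  renaming (_≟_ to _≟ᶠ_)
open import Data.List using (List; []; _∷_; _++_; [_]; head; last)
open import Data.List.Membership.Propositional using (_∈_)
open import Data.List.Properties using (map-tabulate)
import Data.List.Relation.Unary.All as All
open import Data.List.Relation.Unary.AllPairs using (_∷_)
open import Data.List.Relation.Unary.Any using (here; there)
open import Data.Maybe using (just; fromMaybe)
open import Data.Nat using (ℕ; zero; suc; _+_; _*_; _∸_; _≤_; _<_; _≥_; s≤s; z≤n; _<?_)
open import Data.Nat.Induction using (<-wellFounded)
open import Data.Nat.ListAction using (sum)
open import Data.Nat.Properties
  using (_≟_; +-suc; +-cancelˡ-≡; m<m+n; +-monoʳ-<; ≮⇒≥; <-≤-trans; m≤n⇒m≤1+n;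
         m∸n+n≡m; m≤n⇒∃[o]m+o≡n; n<1⇒n≡0; ≤-refl)
open import Data.Product using (∃; ∃₂; _×_; _,_; proj₁; proj₂)
import Data.Product as Product
open import Data.Sum using (_⊎_; inj₁; inj₂)
open import Data.Unit using (⊤; tt)
open import Function using (_∘_; id)
open import Induction.WellFounded using (Acc; acc)
open import Relation.Nullary using (¬_; yes; no)
open import Relation.Nullary.Decidable using (fromWitness)
open import Relation.Binary.PropositionalEquality
  using (_≡_; _≢_; refl; sym; trans; cong; cong₂; subst; module ≡-Reasoning)

indicator : Bool → ℕ
indicator b = if b then 1 else 0

count-suc : ∀ {N} (P : Fin (suc N) → Bool) →
  count P ≡ indicator (P Fin.zero) + count (P ∘ Fin.suc)
count-suc {N} P = cong (λ l → indicator (P Fin.zero) + sum l)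
  (trans (map-tabulate Fin.suc (indicator ∘ P))
         (sym (map-tabulate id (indicator ∘ P ∘ Fin.suc))))

rank : ∀ {N} → (Fin N → Bool) → Fin N → ℕ
rank P Fin.zero    = 0
rank P (Fin.suc x) = indicator (P Fin.zero) + rank (P ∘ Fin.suc) x

rank<count : ∀ {N} (P : Fin N → Bool) {x} → T (P x) → rank P x < count P
rank<count {suc N} P {Fin.zero} Px rewrite count-suc P with P Fin.zero
... | true = s≤s z≤n
rank<count {suc N} P {Fin.suc x} Px rewrite count-suc P =
  +-monoʳ-< (indicator (P Fin.zero)) (rank<count (P ∘ Fin.suc) Px)

rank-injective : ∀ {N} (P : Fin N → Bool) {x y} → T (P x) → T (P y) →
  rank P x ≡ rank P y → x ≡ y
rank-injective P {Fin.zero}  {Fin.zero}  _  _  _ = refl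
rank-injective P {Fin.zero}  {Fin.suc _} Px _  e with P Fin.zero
rank-injective P {Fin.zero}  {Fin.suc _} _  _  () | true
rank-injective P {Fin.suc _} {Fin.zero}  _  Py e with P Fin.zero
rank-injective P {Fin.suc _} {Fin.zero}  _  _  () | true
rank-injective P {Fin.suc x} {Fin.suc y} Px Py e =
  cong Fin.suc (rank-injective (P ∘ Fin.suc) Px Py (+-cancelˡ-≡ (indicator (P Fin.zero)) _ _ e))

count≡1⇒unique : ∀ {N} (P : Fin N → Bool) → count P ≡ 1 →
  ∀ {x y} → T (P x) → T (P y) → x ≡ y
count≡1⇒unique P c≡1 Px Py = rank-injective P Px Py
  (trans (rank≡0 Px) (sym (rank≡0 Py)))
  where
  rank≡0 : ∀ {x} → T (P x) → rank P x ≡ 0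
  rank≡0 {x} Px = n<1⇒n≡0 (subst (rank P x <_) c≡1 (rank<count P Px))

count≡suc⇒∃ : ∀ {N} (P : Fin N → Bool) {k} → count P ≡ suc k → ∃ λ x → T (P x)
count≡suc⇒∃ {suc N} P c≡1+k with P Fin.zero in P0 | trans (sym (count-suc P)) c≡1+k
... | true  | _  = Fin.zero , subst T (sym P0) tt
... | false | c′ = Product.map Fin.suc id (count≡suc⇒∃ (P ∘ Fin.suc) c′)

module _ {A : Set} (f : A → A) where

  iterate-+ : ∀ l k x → iterate f (l + k) x ≡ iterate f l (iterate f k x)
  iterate-+ zero    k x = refl
  iterate-+ (suc l) k x = cong f (iterate-+ l k x)

  iterate-suc : ∀ k x → iterate f (suc k) x ≡ iterate f k (f x)
  iterate-suc zero    x = refl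
  iterate-suc (suc k) x = cong f (iterate-suc k x)

  iterate-preserves : {P : A → Set} → (∀ {x} → P x → P (f x)) →
    ∀ k {x} → P x → P (iterate f k x)
  iterate-preserves f-pres zero    Px = Px
  iterate-preserves {P} f-pres (suc k) Px = f-pres (iterate-preserves {P} f-pres k Px)

  iterate-injectiveOn : {P : A → Set} → (∀ {x} → P x → P (f x)) →
    (∀ {x y} → P x → P y → f x ≡ f y → x ≡ y) →
    ∀ k {x y} → P x → P y → iterate f k x ≡ iterate f k y → x ≡ y
  iterate-injectiveOn f-pres f-inj zero    Px Py e = e
  iterate-injectiveOn {P} f-pres f-inj (suc k) Px Py e = iterate-injectiveOn {P} f-pres f-inj k Px Py
    (f-inj (iterate-preserves {P} f-pres k Px) (iterate-preserves {P} f-pres k Py) e)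

  iterate-recurrent : ∀ {x j p} → iterate f j x ≡ iterate f (j + suc p) x →
    ∀ i → ∃ λ i′ → i′ < j + suc p × iterate f i′ x ≡ iterate f i x
  iterate-recurrent {x} {j} {p} fʲx≡fᴶx i = go i (<-wellFounded i)
    where
    J = j + suc p
    go : ∀ i → Acc _<_ i → ∃ λ i′ → i′ < J × iterate f i′ x ≡ iterate f i x
    go i (acc rs) with i <? J
    ... | yes i<J = i , i<J , refl
    ... | no  i≮J =
      let i′ , i′<J , eq = go (i ∸ J + j) (rs shorter) in i′ , i′<J , trans eq unwind
      where
      open ≡-Reasoning
      J≤i : J ≤ i
      J≤i = ≮⇒≥ i≮J
      shorter : i ∸ J + j < i
      shorter = subst (i ∸ J + j <_) (m∸n+n≡m J≤i) (+-monoʳ-< (i ∸ J) (m<m+n j (s≤s z≤n)))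
      unwind : iterate f (i ∸ J + j) x ≡ iterate f i x
      unwind = begin
        iterate f (i ∸ J + j) x           ≡⟨ iterate-+ (i ∸ J) j x ⟩
        iterate f (i ∸ J) (iterate f j x) ≡⟨ cong (iterate f (i ∸ J)) fʲx≡fᴶx ⟩
        iterate f (i ∸ J) (iterate f J x) ≡⟨ sym (iterate-+ (i ∸ J) J x) ⟩
        iterate f (i ∸ J + J) x           ≡⟨ cong (λ k → iterate f k x) (m∸n+n≡m J≤i) ⟩
        iterate f i x                     ∎

ℕ-pigeonhole : ∀ {k} (g : ℕ → Fin k) → ∃₂ λ i p → i + suc p ≤ k × g i ≡ g (i + suc p)
ℕ-pigeonhole {k} g with pigeonhole ≤-refl (g ∘ toℕ)
... | i , j , i<j , gi≡gj with m≤n⇒∃[o]m+o≡n i<j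
... | p , 1+i+p≡j = toℕ i , p ,
  subst (_≤ k) (sym i+1+p≡j) (toℕ≤pred[n] j) , trans gi≡gj (cong g (sym i+1+p≡j))
  where
  i+1+p≡j : toℕ i + suc p ≡ toℕ j
  i+1+p≡j = trans (+-suc (toℕ i) p) 1+i+p≡j

iterate-within-count : ∀ {N} (P : Fin N → Bool) (f : Fin N → Fin N) x →
  (∀ i → T (P (iterate f i x))) →
  ∀ i → ∃ λ i′ → i′ < count P × iterate f i′ x ≡ iterate f i x
iterate-within-count P f x P-iterates i with ℕ-pigeonhole code
  where
  code : ℕ → Fin (count P)
  code i = fromℕ< (rank<count P (P-iterates i))
... | j , p , j+1+p≤count , codes≡ with iterate-recurrent f repeat i
  where
  repeat : iterate f j x ≡ iterate f (j + suc p) x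
  repeat = rank-injective P (P-iterates j) (P-iterates (j + suc p))
    (fromℕ<-injective _ _ (rank<count P (P-iterates j)) (rank<count P (P-iterates (j + suc p))) codes≡)
... | i′ , i′<j+1+p , eq = i′ , <-≤-trans i′<j+1+p j+1+p≤count , eq

∈-last : ∀ {A : Set} {x : A} xs → last xs ≡ just x → x ∈ xs
∈-last (_ ∷ [])     refl = here refl
∈-last (_ ∷ y ∷ xs) e    = there (∈-last (y ∷ xs) e)

Reduced-tail : ∀ {N} {x : Fin N} xs → Reduced (x ∷ xs) → Reduced xs
Reduced-tail []          _ = tt
Reduced-tail (_ ∷ [])    _ = tt
Reduced-tail (_ ∷ _ ∷ _) r = proj₂ r

NoStepFromTo : ∀ {N} → Fin N → Fin N → List (Fin N) → Set
NoStepFromTo x y (u ∷ v ∷ rest) = ¬ (u ≡ x × v ≡ y) × NoStepFromTo x y (v ∷ rest)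
NoStepFromTo x y _              = ⊤

module _ {N : ℕ} (t : Tree N) where

  adjacent-sym : ∀ {x y} → Adjacent t x y → Adjacent t y x
  adjacent-sym {x} {y} = subst T (symmetric t x y)

  module _ {a b : Fin N} (ab : Adjacent t a b) where

    -- The stack obtained by reducing a walk from b that never steps from b to a, read
    -- from the current vertex x back to b.
    record Trail (x : Fin N) : Set where
      constructor trail
      field
        rest    : List (Fin N)
        edges   : Edges (adj t) (x ∷ rest)
        reduced : Reduced (x ∷ rest)
        avoids  : NoStepFromTo a b (x ∷ rest)
        endsAt  : last (x ∷ rest) ≡ just b

    trail-step : ∀ {x y} → Trail x → Adjacent t x y → ¬ (x ≡ b × y ≡ a) → Trail y
    trail-step {x} {y} (trail [] _ _ _ end) xy x→y≢b→a =
      trail (x ∷ []) (adjacent-sym xy , tt) tt ((λ (y≡a , x≡b) → x→y≢b→a (x≡b , y≡a)) , tt) end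
    trail-step {x} {y} (trail (z ∷ rest) e r s end) xy x→y≢b→a with y ≟ᶠ z
    ... | yes refl = trail rest (proj₂ e) (Reduced-tail (y ∷ rest) r) (proj₂ s) end
    ... | no  y≢z  = trail (x ∷ z ∷ rest) (adjacent-sym xy , e) (y≢z , r)
                       ((λ (y≡a , x≡b) → x→y≢b→a (x≡b , y≡a)) , s) end

    ¬trail-at-a : ¬ Trail a
    ¬trail-at-a (trail [] _ _ _ refl) = subst T (loopless t a) ab
    ¬trail-at-a (trail (y ∷ rest) e r s end)
      with acyclic t (b ∷ a ∷ y ∷ rest) (adjacent-sym ab , e) ((λ b≡y → proj₁ s (refl , sym b≡y)) , r)
    ... | b∉ ∷ _ = All.lookup b∉ (∈-last (a ∷ y ∷ rest) end) refl

    walk-crosses : (g : ℕ → Fin N) → (∀ j → Adjacent t (g j) (g (suc j))) →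
      ∀ k → Trail (g 0) → g k ≡ a → ∃ λ j → g j ≡ b × g (suc j) ≡ a
    walk-crosses g steps zero    tr g0≡a = ⊥-elim (¬trail-at-a (subst Trail g0≡a tr))
    walk-crosses g steps (suc k) tr gk≡a with g 0 ≟ᶠ b | g 1 ≟ᶠ a
    ... | yes g0≡b | yes g1≡a = 0 , g0≡b , g1≡a
    ... | no  g0≢b | _        = Product.map suc id
      (walk-crosses (g ∘ suc) (steps ∘ suc) k (trail-step tr (steps 0) (g0≢b ∘ proj₁)) gk≡a)
    ... | _        | no  g1≢a = Product.map suc id
      (walk-crosses (g ∘ suc) (steps ∘ suc) k (trail-step tr (steps 0) (g1≢a ∘ proj₂)) gk≡a)

  walk-to-neighbour-uses-edge : ∀ {a b} → Adjacent t a b →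
    (g : ℕ → Fin N) → (∀ j → Adjacent t (g j) (g (suc j))) →
    ∀ {k} → g 0 ≡ b → g k ≡ a → ∃ λ j → g j ≡ b × g (suc j) ≡ a
  walk-to-neighbour-uses-edge ab g steps {k} g0≡b =
    walk-crosses ab g steps k (subst (Trail ab) (sym g0≡b) (trail [] tt tt tt refl))

module Darts {N : ℕ} (n : ℕ) (n≥2 : n ≥ 2) (t : Tree N)
  (valence : ∀ u → External t u ⊎ Internal n t u)
  (σ : Fin N → Fin N → Fin N) (orientation : IsOrientation n t σ) where

  leaf-neighbour : ∀ {u} → External t u → ∃ (Adjacent t u)
  leaf-neighbour {u} = count≡suc⇒∃ (adj t u)

  leaf-neighbour-unique : ∀ {u x y} → External t u → Adjacent t u x → Adjacent t u y → x ≡ y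
  leaf-neighbour-unique {u} leaf = count≡1⇒unique (adj t u) leaf

  ¬external∧internal : ∀ {u} → External t u → ¬ Internal n t u
  ¬external∧internal leaf internal = 1≢n (trans (sym leaf) internal) n≥2
    where
    1≢n : ∀ {k} → 1 ≡ k → k ≥ 2 → ⊥
    1≢n refl (s≤s ())

  two-neighbours⇒internal : ∀ {u x y} → Adjacent t u x → Adjacent t u y → x ≢ y → Internal n t u
  two-neighbours⇒internal {u} ux uy x≢y with valence u
  ... | inj₁ leaf     = ⊥-elim (x≢y (leaf-neighbour-unique leaf ux uy))
  ... | inj₂ internal = internal

  Dart : Set
  Dart = Fin N × Fin N

  IsDart : Dart → Set
  IsDart (a , b) = Adjacent t a b

  HeadExternal : Dart → Set
  HeadExternal (a , b) = External t a

  turn : Fin N → Fin N → Fin N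
  turn a b with degree t b ≟ n
  ... | yes _ = σ b a
  ... | no  _ = a

  next : Dart → Dart
  next (a , b) = b , turn a b

  next-internal : ∀ {a b} → Internal n t b → next (a , b) ≡ (b , σ b a)
  next-internal {a} {b} internal with degree t b ≟ n
  ... | yes _          = refl
  ... | no  ¬internal = ⊥-elim (¬internal internal)

  next-turn : ∀ {a b c} → Adjacent t a b → Adjacent t b c → a ≢ c → σ b a ≡ c → next (a , b) ≡ (b , c)
  next-turn {b = b} ab bc a≢c σba≡c =
    trans (next-internal (two-neighbours⇒internal (adjacent-sym t ab) bc a≢c)) (cong (b ,_) σba≡c)

  next-leaf : ∀ {a b} → External t b → next (a , b) ≡ (b , a)
  next-leaf {a} {b} leaf with degree t b ≟ n
  ... | yes internal = ⊥-elim (¬external∧internal leaf internal)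
  ... | no  _        = refl

  next-preserves-IsDart : ∀ {d} → IsDart d → IsDart (next d)
  next-preserves-IsDart {a , b} ab with valence b
  ... | inj₁ leaf     = subst IsDart (sym (next-leaf leaf)) (adjacent-sym t ab)
  ... | inj₂ internal = subst IsDart (sym (next-internal internal))
                          (proj₁ (orientation b internal) a (adjacent-sym t ab))

  next-injective : ∀ {d e} → IsDart d → IsDart e → next d ≡ next e → d ≡ e
  next-injective {a , b} {a′ , b′} ab a′b′ eq with cong proj₁ eq
  ... | refl with valence b
  ... | inj₁ leaf = cong (_, b) (cong proj₂ (trans (sym (next-leaf leaf)) (trans eq (next-leaf leaf))))
  ... | inj₂ internal = cong (_, b) (proj₁ (proj₂ (orientation b internal)) a a′
        (adjacent-sym t ab) (adjacent-sym t a′b′)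
        (cong proj₂ (trans (sym (next-internal internal)) (trans eq (next-internal internal)))))

  iterate-next-IsDart : ∀ k {d} → IsDart d → IsDart (iterate next k d)
  iterate-next-IsDart = iterate-preserves next {IsDart} next-preserves-IsDart

  next-periodic : ∀ {d} → IsDart d → ∃ λ p → iterate next (suc p) d ≡ d
  next-periodic {d} d-dart with ℕ-pigeonhole code
    where
    code : ℕ → Fin (N * N)
    code j = combine (proj₁ (iterate next j d)) (proj₂ (iterate next j d))
  ... | i , p , _ , codes≡ = p , sym (iterate-injectiveOn next {IsDart} next-preserves-IsDart next-injective i
    d-dart (iterate-next-IsDart (suc p) d-dart)
    (trans (cong₂ _,_ (proj₁ same) (proj₂ same)) (iterate-+ next i (suc p) d)))
    where
    same = combine-injective _ _ _ _ codes≡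

  Reaches : Dart → Dart → Set
  Reaches d e = ∃ λ k → iterate next k d ≡ e

  reaches-next : ∀ {d e} → Reaches d e → Reaches d (next e)
  reaches-next (k , eq) = suc k , cong next eq

  reaches-trans : ∀ {d e f} → Reaches d e → Reaches e f → Reaches d f
  reaches-trans {d} (k , dk≡e) (l , el≡f) =
    l + k , trans (iterate-+ next l k d) (trans (cong (iterate next l) dk≡e) el≡f)

  -- The vertices visited by the orbit of (a , b) form a closed walk through b, so it
  -- must cross back from b to a.
  reaches-reverse : ∀ {a b} → Adjacent t a b → Reaches (a , b) (b , a)
  reaches-reverse {a} {b} ab
    with next-periodic {a , b} ab
  ... | p , back with walk-to-neighbour-uses-edge t ab visited
                        (λ j → iterate-next-IsDart (suc j) ab) {p} refl (cong proj₁ back)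
    where
    visited : ℕ → Fin N
    visited j = proj₁ (iterate next (suc j) (a , b))
  ... | j , vj≡b , vj+1≡a = suc j , cong₂ _,_ vj≡b vj+1≡a

  module _ {d : Dart} (d-dart : IsDart d) where

    reached-IsDart : ∀ {e} → Reaches d e → IsDart e
    reached-IsDart (k , eq) = subst IsDart eq (iterate-next-IsDart k d-dart)

    reaches-reversed : ∀ {x y} → Reaches d (x , y) → Reaches d (y , x)
    reaches-reversed r = reaches-trans r (reaches-reverse (reached-IsDart r))

    reaches-around : ∀ {c b} → Reaches d (c , b) → ∀ {c′} → Adjacent t c′ b → Reaches d (c′ , b)
    reaches-around {c} {b} r {c′} c′b with valence b
    ... | inj₁ leaf = subst (λ z → Reaches d (z , b))
      (leaf-neighbour-unique leaf (adjacent-sym t (reached-IsDart r)) (adjacent-sym t c′b)) r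
    ... | inj₂ internal
      with proj₂ (proj₂ (orientation b internal)) c c′
             (adjacent-sym t (reached-IsDart r)) (adjacent-sym t c′b)
    ... | i , σⁱc≡c′ = subst (λ z → Reaches d (z , b)) σⁱc≡c′ (rotate i)
      where
      rotate : ∀ i → Reaches d (iterate (σ b) i c , b)
      rotate zero    = r
      rotate (suc i) = reaches-reversed (subst (Reaches d) (next-internal internal) (reaches-next (rotate i)))

    reaches-onward : ∀ {c x y} → Reaches d (c , x) → Adjacent t x y → Reaches d (x , y)
    reaches-onward r xy = reaches-reversed (reaches-around r (adjacent-sym t xy))

    reaches-along : ∀ {c x} mid y → Reaches d (c , x) → Edges (adj t) (x ∷ mid ++ [ y ]) →
      ∃ λ c′ → Reaches d (c′ , y)
    reaches-along {x = x} []        y r (xy , _) = x , reaches-onward r xy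
    reaches-along         (z ∷ mid) y r (xz , E) = reaches-along mid y (reaches-onward r xz) E

    reaches-into : ∀ y → ∃ λ c → Reaches d (c , y)
    reaches-into y with proj₂ d ≟ᶠ y
    ... | yes refl = proj₁ d , 0 , refl
    ... | no  d₂≢y = let mid , E = connected t (proj₂ d) y d₂≢y in reaches-along mid y (0 , refl) E

    reaches-all : ∀ {x y} → Adjacent t x y → Reaches d (x , y)
    reaches-all {y = y} xy = reaches-around (proj₂ (reaches-into y)) xy

  ReachedFrom : Fin N → ℕ → Dart → Set
  ReachedFrom w K e = ∃₂ λ x K′ → Adjacent t w x × K′ ≤ K × iterate next K′ (w , x) ≡ e

  module _ {w : Fin N} (w-leaf : External t w) where

    follow-internal : ∀ {a c c′} → Adjacent t a c → Adjacent t c c′ → a ≢ c′ → σ c a ≡ c′ →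
      (∀ K → HeadExternal (iterate next (suc K) (c , c′)) →
         ReachedFrom w K (iterate next (suc K) (c , c′))) →
      ∀ K → HeadExternal (iterate next (suc K) (a , c)) →
        ReachedFrom w K (iterate next (suc K) (a , c))
    follow-internal ac cc′ a≢c′ _ _ zero leaf =
      ⊥-elim (¬external∧internal leaf (two-neighbours⇒internal (adjacent-sym t ac) cc′ a≢c′))
    follow-internal {a} {c} {c′} ac cc′ a≢c′ σca≡c′ onward (suc K) leaf =
      let x , K′ , wx , K′≤K , eq = onward K (subst HeadExternal (shift (suc K)) leaf)
      in x , K′ , wx , m≤n⇒m≤1+n K′≤K , trans eq (sym (shift (suc K)))
      where
      shift : ∀ k → iterate next (suc k) (a , c) ≡ iterate next k (c , c′)
      shift k = trans (iterate-suc next k (a , c)) (cong (iterate next k) (next-turn ac cc′ a≢c′ σca≡c′))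

    -- The orbit of the first dart of a reduced, well-oriented path to the leaf w meets
    -- no leaf before leaving w.
    follow-path : ∀ a mid → let path = a ∷ mid ++ [ w ] in
      Edges (adj t) path → Reduced path → WellOriented σ path →
      ∀ K → HeadExternal (iterate next (suc K) (a , fromMaybe w (head mid))) →
        ReachedFrom w K (iterate next (suc K) (a , fromMaybe w (head mid)))
    follow-path a [] (aw , _) _ _ K _ =
      a , K , adjacent-sym t aw , ≤-refl ,
      sym (trans (iterate-suc next K (a , w)) (cong (iterate next K) (next-leaf w-leaf)))
    follow-path a (c ∷ []) (ac , E) (a≢w , _) (σca≡w , _) =
      follow-internal ac (proj₁ E) a≢w σca≡w (follow-path c [] E tt tt)
    follow-path a (c ∷ c′ ∷ mid) (ac , E) (a≢c′ , R) (σca≡c′ , W) =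
      follow-internal ac (proj₁ E) a≢c′ σca≡c′ (follow-path c (c′ ∷ mid) E R W)

  path-start : ∀ {v} mid w → Edges (adj t) (v ∷ mid ++ [ w ]) → Adjacent t v (fromMaybe w (head mid))
  path-start []      w (vw , _) = vw
  path-start (_ ∷ _) w (vc , _) = vc

  module _ (r : Fin N → Fin N) (r-path : ∀ v → External t v → External t (r v) × RWOPath t σ v (r v)) where

    leaf-darts-in-r-orbit : ∀ {v y w x} → External t v → Adjacent t v y → External t w →
      Reaches (v , y) (w , x) → ∃ λ i → iterate r i v ≡ w
    leaf-darts-in-r-orbit {w = w} {x} v-leaf vy w-leaf (K , eq) = go K (<-wellFounded K) v-leaf vy eq
      where
      go : ∀ K → Acc _<_ K → ∀ {v y} → External t v → Adjacent t v y →
        iterate next K (v , y) ≡ (w , x) → ∃ λ i → iterate r i v ≡ w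
      go zero    _        _      _  eq = 0 , cong proj₁ eq
      go (suc K) (acc rs) {v} v-leaf vy eq
        with r-path v v-leaf
      ... | rv-leaf , mid , E , R , W
        with leaf-neighbour-unique v-leaf vy (path-start mid (r v) E)
      ... | refl
        with follow-path rv-leaf v mid E R W K (subst HeadExternal (sym eq) w-leaf)
      ... | x′ , K′ , rv-x′ , K′≤K , eq′ =
        let i , rⁱrv≡w = go K′ (rs (s≤s K′≤K)) rv-leaf rv-x′ (trans eq′ eq)
        in suc i , trans (iterate-suc r i v) rⁱrv≡w

    r-orbit-contains-leaves : ∀ {v w} → External t v → External t w → ∃ λ i → iterate r i v ≡ w
    r-orbit-contains-leaves v-leaf w-leaf =
      let y , vy = leaf-neighbour v-leaf
          x , wx = leaf-neighbour w-leaf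
      in leaf-darts-in-r-orbit v-leaf vy w-leaf (reaches-all vy wx)

lemma3p23 : (n m N : ℕ) → n ≥ 2 → m ≥ 1 →
    (t : Tree N) → InBi m n t →
    (σ : Fin N → Fin N → Fin N) → IsOrientation n t σ →
    (r : Fin N → Fin N) →
    (∀ v → External t v → External t (r v) × RWOPath t σ v (r v)) →
    ∀ v → External t v →
      ((i : ℕ) → i < numExternal t → External t (iterate r i v)) ×
      (∀ w → External t w →
        ∃ λ i → i < numExternal t × iterate r i v ≡ w)
lemma3p23 n m N n≥2 _ t bi σ orientation r r-path v v-leaf =
  (λ i _ → r-iterates-leaves i) , λ w w-leaf →
    let i , rⁱv≡w = r-orbit-contains-leaves r r-path v-leaf w-leaf
        i′ , i′<count , eq = iterate-within-count (isExternal t) r v (fromWitness ∘ r-iterates-leaves) i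
    in i′ , i′<count , trans eq rⁱv≡w
  where
  open Darts n n≥2 t (InBi.valence bi) σ orientation
  r-iterates-leaves : ∀ i → External t (iterate r i v)
  r-iterates-leaves i = iterate-preserves r {External t} (λ {u} u-leaf → proj₁ (r-path u u-leaf)) i v-leaf
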